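{- Let $N\ge1$, $f:\mathbb{N}^N\to\mathbb{N}$, $k\ge1$ and $\boldsymbol{\ell}=(\ell_1,\dots,\ell_N)\in\mathbb{N}^N$. For $i=1,\dots,N$ let $d_i=\gcd(k,\ell_i)$ and $t_i=k/d_i$. Then $t_i$ divides $\binom{k}{\boldsymbol{\ell}}_f$ for every $i=1,\dots,N$; equivalently, $\operatorname{lcm}(t_1,\dots,t_N)$ divides $\binom{k}{\boldsymbol{\ell}}_f$.
   Context: $\mathbb{N}=\{0,1,2,\dots\}$. For $k\ge0$ and $\boldsymbol{\ell}\in\mathbb{N}^N$, $\binom{k}{\boldsymbol{\ell}}_f=\sum f(\mathbf{m}_1)\cdots f(\mathbf{m}_k)$ over all ordered $k$-tuples of vectors $\mathbf{m}_j\in\mathbb{N}^N$ with $\mathbf{m}_1+\cdots+\mathbf{m}_k=\boldsymbol{\ell}$. -}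

module Defs where

open import Data.Nat using (ℕ; zero; suc; _+_; _*_; _≟_)
open import Data.Nat.GCD using (gcd)
open import Data.Nat.LCM using (lcm)
open import Data.List using (List; []; _∷_; map; concatMap; upTo; filter; foldr)
open import Data.Nat.ListAction using (sum; product)
open import Data.Nat using (_/_)
open import Data.Nat.GCD using (gcd[m,n]≢0)
open import Data.Nat.Properties using (1+n≢0)
open import Data.Sum using (inj₁)
open import Data.Nat.Base using (≢-nonZero)
open import Data.Vec using (Vec; []; _∷_; zipWith; replicate)
open import Data.Vec.Properties using (≡-dec)
open import Relation.Binary.PropositionalEquality using (_≡_)
open import Relation.Nullary using (Dec)

boxVecs : ∀ {N} → Vec ℕ N → List (Vec ℕ N)
boxVecs [] = [] ∷ []
boxVecs (l ∷ ls) = concatMap (λ a → map (a ∷_) (boxVecs ls)) (upTo (suc l))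

tuples : ∀ {N} → ℕ → Vec ℕ N → List (List (Vec ℕ N))
tuples zero ℓ = [] ∷ []
tuples (suc k) ℓ = concatMap (λ m → map (m ∷_) (tuples k ℓ)) (boxVecs ℓ)

vsum : ∀ {N} → List (Vec ℕ N) → Vec ℕ N
vsum {N} = foldr (zipWith _+_) (replicate N 0)

-- The f-multinomial coefficient  binom(k, ℓ)_f = Σ f(m_1)⋯f(m_k) over ordered
-- k-tuples (m_1,…,m_k) of vectors in ℕ^N with m_1+⋯+m_k = ℓ.
-- (Every such m_j satisfies m_j ≤ ℓ componentwise, so the enumeration over
-- boxVecs ℓ covers all tuples, each exactly once.)
multinom : ∀ {N} → (Vec ℕ N → ℕ) → ℕ → Vec ℕ N → ℕ
multinom {N} f k ℓ =
  sum (map (λ ms → product (map f ms))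
           (filter (λ ms → ≡-dec _≟_ (vsum ms) ℓ) (tuples k ℓ)))

lcmVec : ∀ {N} → Vec ℕ N → ℕ
lcmVec [] = 1
lcmVec (x ∷ xs) = lcm x (lcmVec xs)

-- t = k / gcd(k, l), for k ≥ 1 (so gcd(k,l) ≠ 0). For k = 0 the value is
-- irrelevant (the theorem assumes k ≥ 1); we set it to 0.
tDiv : ℕ → ℕ → ℕ
tDiv zero l = 0
tDiv (suc k) l = (suc k / gcd (suc k) l) {{≢-nonZero (gcd[m,n]≢0 (suc k) l (inj₁ 1+n≢0))}}

module Submission where

-- Rotating a tuple (m₁,…,m_k) preserves both the constraint m₁+⋯+m_k = ℓ and the weight
-- f(m₁)⋯f(m_k), so each position j contributes the same amount D = Σ (m₁)ᵢ f(m₁)⋯f(m_k) to the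
-- sum over all tuples of Σⱼ (mⱼ)ᵢ f(m₁)⋯f(m_k), which is ℓᵢ·binom(k,ℓ)_f.  Hence
-- ℓᵢ·binom(k,ℓ)_f = k·D; dividing by d = gcd(k,ℓᵢ) gives (ℓᵢ/d)·binom(k,ℓ)_f = (k/d)·D,
-- and k/d is coprime to ℓᵢ/d.

open import Defs
open import Data.Nat using (ℕ; _≥_; zero; suc; _+_; _*_; _≟_; NonZero; _/_)
open import Data.Nat.Base using (≢-nonZero)
open import Data.Nat.Properties
  using (+-assoc; +-identityʳ; *-zeroʳ; *-distribˡ-+; *-distribʳ-+; *-cancelʳ-≡;
         +-commutativeSemigroup; *-commutativeSemigroup)
open import Algebra.Properties.CommutativeSemigroup +-commutativeSemigroup using (interchange)
open import Algebra.Properties.CommutativeSemigroup *-commutativeSemigroup using (xy∙z≈xz∙y; xy∙z≈zx∙y)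
open import Data.Nat.Divisibility using (_∣_; divides; 1∣_)
open import Data.Nat.GCD using (gcd; gcd[m,n]∣m; gcd[m,n]∣n; gcd[m,n]≢0)
open import Data.Nat.LCM using (lcm-least)
open import Data.Nat.DivMod using (m/n*n≡m)
open import Data.Nat.Coprimality using (coprime-/gcd; coprime-divisor)
open import Data.Nat.ListAction using (sum; product)
open import Data.Nat.ListAction.Properties using (sum-↭; product-↭)
open import Data.Fin using (Fin; zero; suc)
open import Data.Vec using (Vec; lookup; tabulate)
open import Data.Vec.Properties using (≡-dec; lookup-zipWith; lookup-replicate)
open import Data.Vec.Relation.Binary.Pointwise.Extensional using (ext; Pointwise-≡⇒≡)
open import Data.List using (List; []; _∷_; [_]; _++_; _∷ʳ_; map; concatMap; filter; length; iterate)
open import Data.List.Properties using (++-assoc; ++-identityʳ)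
open import Data.List.Relation.Binary.Permutation.Propositional using (_↭_; ↭-refl; ↭-sym)
import Data.List.Relation.Binary.Permutation.Propositional.Properties as ↭
open import Data.Product using (_×_; _,_)
open import Data.Sum using (inj₁)
open import Data.Bool using (if_then_else_; true; false)
open import Relation.Nullary using (Dec; yes; no; does)
open import Relation.Unary using (Decidable)
open import Relation.Binary.PropositionalEquality using (_≡_; refl; sym; trans; cong; cong₂; module ≡-Reasoning)
open ≡-Reasoning

∑ : {A : Set} → (A → ℕ) → List A → ℕ
∑ g xs = sum (map g xs)

syntax ∑ (λ x → e) xs = ∑[ x ∈ xs ] e

module _ {A : Set} where

  ∑-cong : ∀ {g h : A → ℕ} xs → (∀ x → g x ≡ h x) → ∑ g xs ≡ ∑ h xs
  ∑-cong []       g≗h = refl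
  ∑-cong (x ∷ xs) g≗h = cong₂ _+_ (g≗h x) (∑-cong xs g≗h)

  ∑-++ : ∀ (g : A → ℕ) xs ys → ∑ g (xs ++ ys) ≡ ∑ g xs + ∑ g ys
  ∑-++ g []       ys = refl
  ∑-++ g (x ∷ xs) ys = trans (cong (g x +_) (∑-++ g xs ys)) (sym (+-assoc (g x) _ _))

  ∑-+ : ∀ (g h : A → ℕ) xs → ∑[ x ∈ xs ] (g x + h x) ≡ ∑ g xs + ∑ h xs
  ∑-+ g h []       = refl
  ∑-+ g h (x ∷ xs) = trans (cong (g x + h x +_) (∑-+ g h xs)) (interchange (g x) (h x) _ _)

  ∑-*ˡ : ∀ c (g : A → ℕ) xs → ∑[ x ∈ xs ] (c * g x) ≡ c * ∑ g xs
  ∑-*ˡ c g []       = sym (*-zeroʳ c)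
  ∑-*ˡ c g (x ∷ xs) = trans (cong (c * g x +_) (∑-*ˡ c g xs)) (sym (*-distribˡ-+ c (g x) _))

  ∑-zero : ∀ (xs : List A) → ∑[ x ∈ xs ] 0 ≡ 0
  ∑-zero []       = refl
  ∑-zero (x ∷ xs) = ∑-zero xs

  ∑-filter : ∀ {P : A → Set} (P? : Decidable P) (g : A → ℕ) xs →
             ∑ g (filter P? xs) ≡ ∑[ x ∈ xs ] (if does (P? x) then g x else 0)
  ∑-filter P? g []       = refl
  ∑-filter P? g (x ∷ xs) with does (P? x)
  ... | true  = cong (g x +_) (∑-filter P? g xs)
  ... | false = ∑-filter P? g xs

  ∑-↭ : ∀ (g : A → ℕ) {xs ys} → xs ↭ ys → ∑ g xs ≡ ∑ g ys
  ∑-↭ g xs↭ys = sum-↭ (↭.map⁺ g xs↭ys)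

module _ {A B : Set} where

  ∑-map : ∀ (g : B → ℕ) (h : A → B) xs → ∑ g (map h xs) ≡ ∑[ x ∈ xs ] g (h x)
  ∑-map g h []       = refl
  ∑-map g h (x ∷ xs) = cong (g (h x) +_) (∑-map g h xs)

  ∑-concatMap : ∀ (g : B → ℕ) (h : A → List B) xs →
                ∑ g (concatMap h xs) ≡ ∑[ x ∈ xs ] ∑ g (h x)
  ∑-concatMap g h []       = refl
  ∑-concatMap g h (x ∷ xs) = trans (∑-++ g (h x) _) (cong (∑ g (h x) +_) (∑-concatMap g h xs))

  ∑-comm : ∀ (h : A → B → ℕ) xs ys →
           ∑[ x ∈ xs ] ∑[ y ∈ ys ] h x y ≡ ∑[ y ∈ ys ] ∑[ x ∈ xs ] h x y
  ∑-comm h []       ys = sym (∑-zero ys)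
  ∑-comm h (x ∷ xs) ys = trans (cong (∑ (h x) ys +_) (∑-comm h xs ys))
                               (sym (∑-+ (h x) (λ y → ∑[ x ∈ xs ] h x y) ys))

rotate : {A : Set} → List A → List A
rotate []       = []
rotate (x ∷ xs) = xs ∷ʳ x

rotate-↭ : {A : Set} (xs : List A) → rotate xs ↭ xs
rotate-↭ []       = ↭-refl
rotate-↭ (x ∷ xs) = ↭-sym (↭.∷↭∷ʳ x xs)

module Words {A : Set} (B : List A) where

  words : ℕ → List (List A)
  words zero    = [ [] ]
  words (suc k) = concatMap (λ x → map (x ∷_) (words k)) B

  ∑-words-∷ : ∀ k (g : List A → ℕ) →
              ∑ g (words (suc k)) ≡ ∑[ x ∈ B ] ∑[ xs ∈ words k ] g (x ∷ xs)
  ∑-words-∷ k g = trans (∑-concatMap g (λ x → map (x ∷_) (words k)) B)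
                        (∑-cong B λ x → ∑-map g (x ∷_) (words k))

  ∑-words-∷ʳ : ∀ k (g : List A → ℕ) →
               ∑ g (words (suc k)) ≡ ∑[ xs ∈ words k ] ∑[ x ∈ B ] g (xs ∷ʳ x)
  ∑-words-∷ʳ zero    g = trans (∑-words-∷ zero g)
                               (trans (∑-cong B λ x → +-identityʳ _) (sym (+-identityʳ _)))
  ∑-words-∷ʳ (suc k) g = begin
    ∑ g (words (suc (suc k)))                                     ≡⟨ ∑-words-∷ (suc k) g ⟩
    ∑[ x ∈ B ] ∑[ xs ∈ words (suc k) ] g (x ∷ xs)                 ≡⟨ ∑-cong B (λ x → ∑-words-∷ʳ k (λ xs → g (x ∷ xs))) ⟩
    ∑[ x ∈ B ] ∑[ xs ∈ words k ] ∑[ y ∈ B ] g (x ∷ (xs ∷ʳ y))      ≡⟨ ∑-words-∷ k (λ xs → ∑[ y ∈ B ] g (xs ∷ʳ y)) ⟨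
    ∑[ xs ∈ words (suc k) ] ∑[ y ∈ B ] g (xs ∷ʳ y)                 ∎

  ∑-words-rotate : ∀ k (g : List A → ℕ) → ∑[ xs ∈ words k ] g (rotate xs) ≡ ∑ g (words k)
  ∑-words-rotate zero    g = refl
  ∑-words-rotate (suc k) g = begin
    ∑[ xs ∈ words (suc k) ] g (rotate xs)          ≡⟨ ∑-words-∷ k (λ xs → g (rotate xs)) ⟩
    ∑[ x ∈ B ] ∑[ xs ∈ words k ] g (xs ∷ʳ x)       ≡⟨ ∑-comm (λ x xs → g (xs ∷ʳ x)) B (words k) ⟩
    ∑[ xs ∈ words k ] ∑[ x ∈ B ] g (xs ∷ʳ x)       ≡⟨ ∑-words-∷ʳ k g ⟨
    ∑ g (words (suc k))                            ∎

  ∑-words-cong : ∀ k {g h : List A → ℕ} → (∀ xs → length xs ≡ k → g xs ≡ h xs) →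
                 ∑ g (words k) ≡ ∑ h (words k)
  ∑-words-cong zero    {g} {h} g≗h = cong (_+ 0) (g≗h [] refl)
  ∑-words-cong (suc k) {g} {h} g≗h = begin
    ∑ g (words (suc k))                       ≡⟨ ∑-words-∷ k g ⟩
    ∑[ x ∈ B ] ∑[ xs ∈ words k ] g (x ∷ xs)   ≡⟨ ∑-cong B (λ x → ∑-words-cong k λ xs |xs| → g≗h (x ∷ xs) (cong suc |xs|)) ⟩
    ∑[ x ∈ B ] ∑[ xs ∈ words k ] h (x ∷ xs)   ≡⟨ ∑-words-∷ k h ⟨
    ∑ h (words (suc k))                       ∎

module RotationSum {A : Set} (φ : A → ℕ) where

  φ-head : List A → ℕ
  φ-head []      = 0
  φ-head (x ∷ _) = φ x

  rotationSum : ℕ → List A → ℕ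
  rotationSum r xs = ∑ φ-head (iterate rotate xs r)

  rotationSum-++ : ∀ xs ys → rotationSum (length xs) (xs ++ ys) ≡ ∑ φ xs
  rotationSum-++ []       ys = refl
  rotationSum-++ (x ∷ xs) ys = cong (φ x +_) (begin
    rotationSum (length xs) ((xs ++ ys) ∷ʳ x)   ≡⟨ cong (rotationSum (length xs)) (++-assoc xs ys [ x ]) ⟩
    rotationSum (length xs) (xs ++ (ys ∷ʳ x))   ≡⟨ rotationSum-++ xs (ys ∷ʳ x) ⟩
    ∑ φ xs                                      ∎)

  rotationSum-length : ∀ {r} xs → length xs ≡ r → rotationSum r xs ≡ ∑ φ xs
  rotationSum-length xs refl =
    trans (cong (rotationSum (length xs)) (sym (++-identityʳ xs))) (rotationSum-++ xs [])

  module _ (B : List A) {H : List A → ℕ} (H-rotate : ∀ xs → H (rotate xs) ≡ H xs) where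
    open Words B

    ∑-words-rotationSum : ∀ k r → ∑[ xs ∈ words k ] (rotationSum r xs * H xs)
                                 ≡ r * ∑[ xs ∈ words k ] (φ-head xs * H xs)
    ∑-words-rotationSum k zero    = ∑-zero (words k)
    ∑-words-rotationSum k (suc r) = begin
      ∑[ xs ∈ words k ] ((φ-head xs + rotationSum r (rotate xs)) * H xs)
        ≡⟨ ∑-cong (words k) (λ xs → *-distribʳ-+ (H xs) (φ-head xs) _) ⟩
      ∑[ xs ∈ words k ] (φ-head xs * H xs + rotationSum r (rotate xs) * H xs)
        ≡⟨ ∑-+ (λ xs → φ-head xs * H xs) (λ xs → rotationSum r (rotate xs) * H xs) (words k) ⟩
      S + ∑[ xs ∈ words k ] (rotationSum r (rotate xs) * H xs)
        ≡⟨ cong (S +_) (∑-cong (words k) λ xs → cong (rotationSum r (rotate xs) *_) (sym (H-rotate xs))) ⟩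
      S + ∑[ xs ∈ words k ] (rotationSum r (rotate xs) * H (rotate xs))
        ≡⟨ cong (S +_) (∑-words-rotate k (λ xs → rotationSum r xs * H xs)) ⟩
      S + ∑[ xs ∈ words k ] (rotationSum r xs * H xs)
        ≡⟨ cong (S +_) (∑-words-rotationSum k r) ⟩
      S + r * S
        ∎
      where S = ∑[ xs ∈ words k ] (φ-head xs * H xs)

    ∑-words-∑ : ∀ k → ∑[ xs ∈ words k ] (∑ φ xs * H xs) ≡ k * ∑[ xs ∈ words k ] (φ-head xs * H xs)
    ∑-words-∑ k = trans
      (∑-words-cong k λ xs |xs| → cong (_* H xs) (sym (rotationSum-length xs |xs|)))
      (∑-words-rotationSum k k)

*-cong-if : ∀ {P : Set} (P? : Dec P) {a b} c → (P → a ≡ b) →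
            a * (if does P? then c else 0) ≡ b * (if does P? then c else 0)
*-cong-if (yes p) c a≡b = cong (_* c) (a≡b p)
*-cong-if (no _) {a} {b} c _ = trans (*-zeroʳ a) (sym (*-zeroʳ b))

tuples≡words : ∀ {N} k (ℓ : Vec ℕ N) → tuples k ℓ ≡ Words.words (boxVecs ℓ) k
tuples≡words zero    ℓ = refl
tuples≡words (suc k) ℓ = cong (λ ts → concatMap (λ m → map (m ∷_) ts) (boxVecs ℓ)) (tuples≡words k ℓ)

lookup-vsum : ∀ {N} (i : Fin N) ms → lookup (vsum ms) i ≡ ∑[ m ∈ ms ] lookup m i
lookup-vsum i []       = lookup-replicate i 0
lookup-vsum i (m ∷ ms) = trans (lookup-zipWith _+_ i m (vsum ms)) (cong (lookup m i +_) (lookup-vsum i ms))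

vsum-rotate : ∀ {N} (ms : List (Vec ℕ N)) → vsum (rotate ms) ≡ vsum ms
vsum-rotate ms = Pointwise-≡⇒≡ (ext λ i → begin
  lookup (vsum (rotate ms)) i       ≡⟨ lookup-vsum i (rotate ms) ⟩
  ∑[ m ∈ rotate ms ] lookup m i     ≡⟨ ∑-↭ (λ m → lookup m i) (rotate-↭ ms) ⟩
  ∑[ m ∈ ms ] lookup m i            ≡⟨ lookup-vsum i ms ⟨
  lookup (vsum ms) i                ∎)

module Multinomial {N} (f : Vec ℕ N → ℕ) (ℓ : Vec ℕ N) where
  open Words (boxVecs ℓ)

  weight : List (Vec ℕ N) → ℕ
  weight ms = product (map f ms)

  summand : List (Vec ℕ N) → ℕ
  summand ms = if does (≡-dec _≟_ (vsum ms) ℓ) then weight ms else 0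

  multinom≡∑summand : ∀ k → multinom f k ℓ ≡ ∑ summand (words k)
  multinom≡∑summand k = trans (∑-filter (λ ms → ≡-dec _≟_ (vsum ms) ℓ) weight (tuples k ℓ))
                              (cong (∑ summand) (tuples≡words k ℓ))

  summand-rotate : ∀ ms → summand (rotate ms) ≡ summand ms
  summand-rotate ms = cong₂ (λ v w → if does (≡-dec _≟_ v ℓ) then w else 0)
                            (vsum-rotate ms) (product-↭ (↭.map⁺ f (rotate-↭ ms)))

  module _ (i : Fin N) where
    open RotationSum (λ m → lookup m i)

    lookup-ℓ*multinom : ∀ k → lookup ℓ i * multinom f k ℓ ≡ k * ∑[ ms ∈ words k ] (φ-head ms * summand ms)
    lookup-ℓ*multinom k = begin
      lookup ℓ i * multinom f k ℓ                                ≡⟨ cong (lookup ℓ i *_) (multinom≡∑summand k) ⟩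
      lookup ℓ i * ∑ summand (words k)                           ≡⟨ ∑-*ˡ (lookup ℓ i) summand (words k) ⟨
      ∑[ ms ∈ words k ] (lookup ℓ i * summand ms)                ≡⟨ ∑-cong (words k) ℓᵢ≡∑ ⟩
      ∑[ ms ∈ words k ] ((∑[ m ∈ ms ] lookup m i) * summand ms)  ≡⟨ ∑-words-∑ (boxVecs ℓ) summand-rotate k ⟩
      k * ∑[ ms ∈ words k ] (φ-head ms * summand ms)             ∎
      where
      ℓᵢ≡∑ : ∀ ms → lookup ℓ i * summand ms ≡ (∑[ m ∈ ms ] lookup m i) * summand ms
      ℓᵢ≡∑ ms = *-cong-if (≡-dec _≟_ (vsum ms) ℓ) (weight ms)
                          (λ vsum≡ℓ → trans (cong (λ v → lookup v i) (sym vsum≡ℓ)) (lookup-vsum i ms))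

m/gcd[m,n]∣o : ∀ m n {o p} .{{_ : NonZero (gcd m n)}} → n * o ≡ m * p → m / gcd m n ∣ o
m/gcd[m,n]∣o m n {o} {p} no≡mp = coprime-divisor (coprime-/gcd m n) (divides p (*-cancelʳ-≡ _ _ d (begin
  n / d * o * d    ≡⟨ xy∙z≈xz∙y (n / d) o d ⟩
  n / d * d * o    ≡⟨ cong (_* o) (m/n*n≡m (gcd[m,n]∣n m n)) ⟩
  n * o            ≡⟨ no≡mp ⟩
  m * p            ≡⟨ cong (_* p) (m/n*n≡m (gcd[m,n]∣m m n)) ⟨
  m / d * d * p    ≡⟨ xy∙z≈zx∙y (m / d) d p ⟩
  p * (m / d) * d  ∎)))
  where d = gcd m n

lcmVec-least : ∀ {n} (g : Fin n → ℕ) {m} → (∀ i → g i ∣ m) → lcmVec (tabulate g) ∣ m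
lcmVec-least {zero}  g {m} g∣m = 1∣ m
lcmVec-least {suc n} g     g∣m = lcm-least (g∣m zero) (lcmVec-least (λ i → g (suc i)) (λ i → g∣m (suc i)))

theorem11 : (N : ℕ) → N ≥ 1 → (f : Vec ℕ N → ℕ) → (k : ℕ) → k ≥ 1 → (ℓ : Vec ℕ N) →
    ((i : Fin N) → tDiv k (lookup ℓ i) ∣ multinom f k ℓ)
      × (lcmVec (tabulate (λ i → tDiv k (lookup ℓ i))) ∣ multinom f k ℓ)
theorem11 N _ f (suc k) _ ℓ = tDiv∣multinom , lcmVec-least _ tDiv∣multinom
  where
  tDiv∣multinom : ∀ i → tDiv (suc k) (lookup ℓ i) ∣ multinom f (suc k) ℓ
  tDiv∣multinom i = m/gcd[m,n]∣o (suc k) (lookup ℓ i)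
    {{≢-nonZero (gcd[m,n]≢0 (suc k) (lookup ℓ i) (inj₁ λ ()))}}
    (Multinomial.lookup-ℓ*multinom f ℓ i (suc k))
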